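{- Let $\theta=e^{\pi i/3}\in\mathbb{C}$ and for $m\ge 1$ let $T_m=\{a+b\theta : a,b\in\mathbb{N},\ a+b<m\}$ (a triangular grid with $m(m+1)/2$ points whose convex hull is an equilateral triangle of side $m-1$). For $m\ge 2$, there exists a $2$-coloring of $T_m$ with no monochromatic equilateral triangle (i.e., no three points of $T_m$ of the same color forming an equilateral triangle, in any orientation) if and only if $m\le 3$. Consequently $\Sigma(\triangle,2)=4$: every $2$-coloring of $T_4$ contains a monochromatic equilateral triangle with vertices in $T_4$.
   Context: $\Sigma(\triangle,2)$ denotes the least $m$ such that every $2$-coloring of $T_m$ contains three points of the same color forming an equilateral triangle (of any orientation and size). -}

module Defs where

open import Data.Nat using (ℕ; _+_; _<_; _≤_)
open import Data.Integer as ℤ using (ℤ; +_)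
open import Data.Bool using (Bool)
open import Data.Product using (Σ; _×_; ∃-syntax)
open import Relation.Binary.PropositionalEquality using (_≡_)
open import Relation.Nullary using (¬_)

-- A point a + bθ of T_m, θ = e^{πi/3}, with a, b ∈ ℕ and a + b < m.
record Pt (m : ℕ) : Set where
  constructor pt
  field
    a   : ℕ
    b   : ℕ
    a+b<m : a + b < m
open Pt public

-- Two points are equal as complex numbers iff their (a,b) coordinates agree
-- (1 and θ are ℝ-linearly independent).
SamePoint : ∀ {m} → Pt m → Pt m → Set
SamePoint p q = (a p ≡ a q) × (b p ≡ b q)

-- |x + yθ|² = x² + xy + y²  (since Re θ = 1/2, |θ| = 1)
normSq : ℤ → ℤ → ℤ
normSq x y = x ℤ.* x ℤ.+ x ℤ.* y ℤ.+ y ℤ.* y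

dist² : ∀ {m} → Pt m → Pt m → ℤ
dist² p q = normSq (+ a p ℤ.- + a q) (+ b p ℤ.- + b q)

Equilateral : ∀ {m} → Pt m → Pt m → Pt m → Set
Equilateral p q r =
  ¬ SamePoint p q × ¬ SamePoint q r × ¬ SamePoint p r ×
  dist² p q ≡ dist² q r × dist² q r ≡ dist² p r

Coloring : ℕ → Set
Coloring m = Pt m → Bool

HasMonoTriangle : ∀ {m} → Coloring m → Set
HasMonoTriangle {m} c =
  ∃[ p ] ∃[ q ] ∃[ r ] (Equilateral {m} p q r × c p ≡ c q × c q ≡ c r)

Forces : ℕ → Set
Forces m = (c : Coloring m) → HasMonoTriangle c

SigmaTriangle2≡ : ℕ → Set
SigmaTriangle2≡ n = (1 ≤ n × Forces n) × (∀ m → 1 ≤ m → Forces m → n ≤ m)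

{-# OPTIONS --safe #-}

-- Forcing a monochromatic triangle is monotone in m, because T_m sits inside T_n for m ≤ n
-- and the embedding preserves all distances.  So it suffices to give one triangle-free
-- colouring of T_3 and to show that every colouring of T_4 has a monochromatic triangle.
-- Both are finite checks: a colouring of T_4 is a subset of its 10 points, and all 2^10 of
-- them are decided at once.

module Submission where

open import Defs
open import Data.Nat using (ℕ; suc; _+_; _≤_; _<_; _≤?_; s≤s; z≤n)
import Data.Nat.Properties as ℕ
import Data.Integer.Properties as ℤ
open import Data.Bool using (Bool; true; false)
import Data.Bool.Properties as Bool
open import Data.Fin using (Fin; #_)
import Data.Fin.Properties as Fin
open import Data.Fin.Subset using (Subset)
open import Data.Fin.Subset.Properties using (anySubset?)
open import Data.Vec using (Vec; []; _∷_; lookup; tabulate)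
open import Data.Vec.Properties using (lookup∘tabulate)
open import Data.Product using (_×_; ∃-syntax; _,_)
open import Function using (_∘_)
open import Function.Bundles using (_⇔_; mk⇔)
open import Relation.Nullary using (¬_; Dec; ¬?)
open import Relation.Nullary.Decidable using (True; toWitness; from-no; decidable-stable; _×-dec_)
open import Relation.Binary.PropositionalEquality using (_≡_; refl; sym; trans; cong)

private
  variable
    m n : ℕ

samePoint? : (p q : Pt m) → Dec (SamePoint p q)
samePoint? p q = (a p ℕ.≟ a q) ×-dec (b p ℕ.≟ b q)

equilateral? : (p q r : Pt m) → Dec (Equilateral p q r)
equilateral? p q r =
  ¬? (samePoint? p q) ×-dec ¬? (samePoint? q r) ×-dec ¬? (samePoint? p r) ×-dec
  (dist² p q ℤ.≟ dist² q r) ×-dec (dist² q r ℤ.≟ dist² p r)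

inject≤ : Pt m → m ≤ n → Pt n
inject≤ (pt x y x+y<m) m≤n = pt x y (ℕ.≤-trans x+y<m m≤n)

hasMonoTriangle-inject≤ : (m≤n : m ≤ n) (c : Coloring n) →
                          HasMonoTriangle (λ p → c (inject≤ p m≤n)) → HasMonoTriangle c
hasMonoTriangle-inject≤ m≤n c (p , q , r , equilateral , cp≡cq , cq≡cr) =
  inject≤ p m≤n , inject≤ q m≤n , inject≤ r m≤n , equilateral , cp≡cq , cq≡cr

forces-mono : m ≤ n → Forces m → Forces n
forces-mono m≤n forces c = hasMonoTriangle-inject≤ m≤n c (forces (λ p → c (inject≤ p m≤n)))

triangleFree-antimono : m ≤ n → ∃[ c ] ¬ HasMonoTriangle {n} c → ∃[ c ] ¬ HasMonoTriangle {m} c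
triangleFree-antimono m≤n (c , noMono) =
  (λ p → c (inject≤ p m≤n)) , noMono ∘ hasMonoTriangle-inject≤ m≤n c

Covers : Vec (Pt m) n → Set
Covers xs = ∀ p → ∃[ i ] lookup xs i ≡ p

-- Colours are read off the indices of xs.  The colour conditions come first so that
-- deciding it rarely needs to compute distances.
MonoTriangleIn : Vec (Pt m) n → (Fin n → Bool) → Set
MonoTriangleIn xs κ = ∃[ i ] ∃[ j ] ∃[ k ]
  (κ i ≡ κ j × κ j ≡ κ k × Equilateral (lookup xs i) (lookup xs j) (lookup xs k))

monoTriangleIn? : (xs : Vec (Pt m) n) (κ : Fin n → Bool) → Dec (MonoTriangleIn xs κ)
monoTriangleIn? xs κ = Fin.any? λ i → Fin.any? λ j → Fin.any? λ k →
  (κ i Bool.≟ κ j) ×-dec (κ j Bool.≟ κ k) ×-dec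
  equilateral? (lookup xs i) (lookup xs j) (lookup xs k)

monoTriangleIn-resp : (xs : Vec (Pt m) n) {κ κ′ : Fin n → Bool} → (∀ i → κ i ≡ κ′ i) →
                      MonoTriangleIn xs κ → MonoTriangleIn xs κ′
monoTriangleIn-resp xs {κ} {κ′} κ≗κ′ (i , j , k , κi≡κj , κj≡κk , equilateral) =
  i , j , k , resp i j κi≡κj , resp j k κj≡κk , equilateral
  where
  resp : ∀ i j → κ i ≡ κ j → κ′ i ≡ κ′ j
  resp i j e = trans (sym (κ≗κ′ i)) (trans e (κ≗κ′ j))

monoTriangleIn⇒hasMonoTriangle : (xs : Vec (Pt m) n) (c : Coloring m) →
                                 MonoTriangleIn xs (c ∘ lookup xs) → HasMonoTriangle c
monoTriangleIn⇒hasMonoTriangle xs c (i , j , k , ci≡cj , cj≡ck , equilateral) =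
  lookup xs i , lookup xs j , lookup xs k , equilateral , ci≡cj , cj≡ck

hasMonoTriangle⇒monoTriangleIn : (xs : Vec (Pt m) n) → Covers xs → (c : Coloring m) →
                                 HasMonoTriangle c → MonoTriangleIn xs (c ∘ lookup xs)
hasMonoTriangle⇒monoTriangleIn xs covers c (p , q , r , equilateral , cp≡cq , cq≡cr)
  with covers p | covers q | covers r
... | i , refl | j , refl | k , refl = i , j , k , cp≡cq , cq≡cr , equilateral

forces-bySubsets : (xs : Vec (Pt m) n) → (∀ (v : Subset n) → MonoTriangleIn xs (lookup v)) →
                   Forces m
forces-bySubsets xs mono c = monoTriangleIn⇒hasMonoTriangle xs c
  (monoTriangleIn-resp xs (lookup∘tabulate (c ∘ lookup xs)) (mono (tabulate (c ∘ lookup xs))))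

point : (x y : ℕ) → {True (suc (x + y) ≤? m)} → Pt m
point x y {x+y<m} = pt x y (toWitness x+y<m)

pt-irrelevant : {x y : ℕ} (h h′ : x + y < m) → pt x y h ≡ pt x y h′
pt-irrelevant h h′ = cong (pt _ _) (ℕ.≤-irrelevant h h′)

T₃ : Vec (Pt 3) 6
T₃ = point 0 0 ∷ point 0 1 ∷ point 0 2 ∷ point 1 0 ∷ point 1 1 ∷ point 2 0 ∷ []

T₃-covers : Covers T₃
T₃-covers (pt 0 0 h) = # 0 , pt-irrelevant _ h
T₃-covers (pt 0 1 h) = # 1 , pt-irrelevant _ h
T₃-covers (pt 0 2 h) = # 2 , pt-irrelevant _ h
T₃-covers (pt 1 0 h) = # 3 , pt-irrelevant _ h
T₃-covers (pt 1 1 h) = # 4 , pt-irrelevant _ h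
T₃-covers (pt 2 0 h) = # 5 , pt-irrelevant _ h
T₃-covers (pt 0 (suc (suc (suc _))) (s≤s (s≤s (s≤s ()))))
T₃-covers (pt 1 (suc (suc _)) (s≤s (s≤s (s≤s ()))))
T₃-covers (pt 2 (suc _) (s≤s (s≤s (s≤s ()))))
T₃-covers (pt (suc (suc (suc _))) _ (s≤s (s≤s (s≤s ()))))

c₃ : Coloring 3
c₃ (pt 1 0 _) = true
c₃ (pt 0 2 _) = true
c₃ _          = false

c₃-triangleFree : ¬ HasMonoTriangle c₃
c₃-triangleFree =
  from-no (monoTriangleIn? T₃ (c₃ ∘ lookup T₃)) ∘ hasMonoTriangle⇒monoTriangleIn T₃ T₃-covers c₃

T₄ : Vec (Pt 4) 10
T₄ = point 0 0 ∷ point 0 1 ∷ point 0 2 ∷ point 0 3 ∷ point 1 0 ∷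
     point 1 1 ∷ point 1 2 ∷ point 2 0 ∷ point 2 1 ∷ point 3 0 ∷ []

monoTriangleIn-T₄ : (v : Subset 10) → MonoTriangleIn T₄ (lookup v)
monoTriangleIn-T₄ v = decidable-stable (monoTriangleIn? T₄ (lookup v)) λ noMono →
  from-no (anySubset? (λ w → ¬? (monoTriangleIn? T₄ (lookup w)))) (v , noMono)

forces₄ : Forces 4
forces₄ = forces-bySubsets T₄ monoTriangleIn-T₄

triangleFree⇒≤3 : ∃[ c ] ¬ HasMonoTriangle {m} c → m ≤ 3
triangleFree⇒≤3 (c , noMono) = ℕ.≮⇒≥ λ 3<m → noMono (forces-mono 3<m forces₄ c)

≤3⇒triangleFree : m ≤ 3 → ∃[ c ] ¬ HasMonoTriangle {m} c
≤3⇒triangleFree m≤3 = triangleFree-antimono m≤3 (c₃ , c₃-triangleFree)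

mainTheorem3 :
    ((m : ℕ) → 2 ≤ m →
      (∃[ c ] ¬ HasMonoTriangle {m} c) ⇔ m ≤ 3)
    × SigmaTriangle2≡ 4
mainTheorem3 =
  (λ m _ → mk⇔ triangleFree⇒≤3 ≤3⇒triangleFree) ,
  (s≤s z≤n , forces₄) ,
  λ m _ forces → ℕ.≰⇒> λ m≤3 → let (c , noMono) = ≤3⇒triangleFree m≤3 in noMono (forces c)
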